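{- Let $n$ be a positive integer and let $\mathcal{D}$ be the set of prime numbers $p$ with $\frac{n}{2}<p\le n$. Then $-1$ is an eigenvalue of the adjacency matrix of $TCG_n$ with multiplicity at least $|\mathcal{D}|$.
   Context: For a positive integer $n$, $TCG_n$ denotes the simple graph (no loops) with vertex set $\{1,2,\ldots,n\}$ in which two distinct vertices $i,j$ are adjacent if and only if $\gcd(i,j)=1$. Its adjacency matrix is the symmetric $n\times n$ $0/1$ matrix whose $(i,j)$ entry is $1$ iff $i$ and $j$ are adjacent (diagonal entries $0$). The statement with multiplicity at least $0$ is vacuous. -}

module Defs where

open import Data.Nat as ℕ using (ℕ; zero; suc; _<_; _≤_)
import Data.Nat.Properties as ℕP
open import Data.Nat.GCD using (gcd)
open import Data.Nat.Primality using (Prime; prime?)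
open import Data.Fin using (Fin; toℕ; _≟_)
import Data.Fin as Fin
open import Data.Rational using (ℚ; 0ℚ; 1ℚ; _+_; _*_; -_)
open import Data.List using (List; filter; upTo; length)
open import Data.Product using (Σ; _×_)
open import Relation.Nullary using (yes; no)
open import Relation.Nullary.Decidable using (_×-dec_)
open import Relation.Binary.PropositionalEquality using (_≡_)

-- vertex labelled by i : Fin n is the integer (toℕ i + 1) ∈ {1,…,n}
vertex : {n : ℕ} → Fin n → ℕ
vertex i = suc (toℕ i)

TCGAdj : (n : ℕ) → Fin n → Fin n → ℚ
TCGAdj n i j with i ≟ j
... | yes _ = 0ℚ
... | no _ with gcd (vertex i) (vertex j) ℕ.≟ 1
...   | yes _ = 1ℚ
...   | no _ = 0ℚ

∑ : (k : ℕ) → (Fin k → ℚ) → ℚ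
∑ zero f = 0ℚ
∑ (suc k) f = f Fin.zero + ∑ k (λ i → f (Fin.suc i))

mulVec : {n : ℕ} → (Fin n → Fin n → ℚ) → (Fin n → ℚ) → Fin n → ℚ
mulVec {n} A v i = ∑ n (λ j → A i j * v j)

InEigenspace : {n : ℕ} → (Fin n → Fin n → ℚ) → ℚ → (Fin n → ℚ) → Set
InEigenspace A μ v = ∀ i → mulVec A v i ≡ μ * v i

LinearlyIndependent : {k n : ℕ} → (Fin k → Fin n → ℚ) → Set
LinearlyIndependent {k} {n} vs =
  (c : Fin k → ℚ) → (∀ i → ∑ k (λ a → c a * vs a i) ≡ 0ℚ) → ∀ a → c a ≡ 0ℚ

-- μ is an eigenvalue of A with (geometric) multiplicity at least m:
-- the eigenspace of μ contains m linearly independent vectors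
EigenvalueMultAtLeast : {n : ℕ} → (Fin n → Fin n → ℚ) → ℚ → ℕ → Set
EigenvalueMultAtLeast {n} A μ m =
  Σ (Fin m → Fin n → ℚ) λ vs → LinearlyIndependent vs × (∀ a → InEigenspace A μ (vs a))

-- the list of primes p with n/2 < p ≤ n (i.e. n < 2p and p ≤ n), without repetition
bigPrimes : ℕ → List ℕ
bigPrimes n = filter (λ p → prime? p ×-dec (n ℕ.<? 2 ℕ.* p)) (upTo (suc n))

-- Vertex 1 and every prime p with n/2 < p ≤ n are adjacent to all other vertices of TCG_n, since
-- every other label is below 2p and distinct from p.  If u and v are two such dominating vertices,
-- columns u and v of the adjacency matrix are 1 − e_u and 1 − e_v, so A (e_u − e_v) = e_v − e_u.
-- The vectors e_p − e_1 are independent because e_p − e_1 has coordinate 1 at p and 0 at the other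
-- primes.
module Submission where

open import Defs
open import Data.Nat as ℕ using (ℕ; zero; suc; _≤_; _<_; >-nonZero; s≤s⁻¹)
import Data.Nat.Properties as ℕP
open import Data.Nat.GCD using (gcd)
open import Data.Nat.Coprimality using (Coprime; coprime⇒gcd≡1; 1-coprimeTo; coprime-+; prime⇒coprime)
import Data.Nat.Coprimality as Coprime
open import Data.Nat.Primality using (Prime; prime?; prime⇒nonZero; prime⇒nonTrivial)
open import Data.Fin as Fin using (Fin; fromℕ<; _≟_)
import Data.Fin.Properties as FinP
open import Data.Rational using (ℚ; 0ℚ; 1ℚ; _+_; _-_; _*_; -_)
import Data.Rational.Properties as ℚP
open import Data.Rational.Solver using (module +-*-Solver)
open import Data.List using (List; _∷_; length; lookup; upTo)
open import Data.List.Membership.Propositional using (_∈_)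
open import Data.List.Membership.Propositional.Properties using (∈-lookup; ∈-filter⁻; ∈-upTo⁻)
open import Data.List.Relation.Unary.Unique.Propositional using (Unique)
import Data.List.Relation.Unary.Unique.Propositional.Properties as Unique
open import Data.List.Relation.Unary.AllPairs using (_∷_)
import Data.List.Relation.Unary.All as All
open import Data.Product using (_×_; _,_; proj₁; proj₂)
open import Function using (_∘_)
open import Function.Definitions using (Injective)
open import Relation.Binary.Definitions using (tri<; tri≈; tri>)
open import Relation.Nullary using (Dec; yes; no; contradiction)
open import Relation.Nullary.Decidable using (_×-dec_)
open import Relation.Binary.PropositionalEquality

open +-*-Solver

private
  variable
    k n : ℕ

∑-cong : ∀ k {f g : Fin k → ℚ} → (∀ i → f i ≡ g i) → ∑ k f ≡ ∑ k g
∑-cong zero    f≗g = refl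
∑-cong (suc k) f≗g = cong₂ _+_ (f≗g Fin.zero) (∑-cong k (λ i → f≗g (Fin.suc i)))

∑-zero : ∀ k (f : Fin k → ℚ) → (∀ i → f i ≡ 0ℚ) → ∑ k f ≡ 0ℚ
∑-zero zero    f f≗0 = refl
∑-zero (suc k) f f≗0 =
  cong₂ _+_ (f≗0 Fin.zero) (∑-zero k (λ i → f (Fin.suc i)) (λ i → f≗0 (Fin.suc i)))

∑-single : ∀ k (f : Fin k → ℚ) u → (∀ i → i ≢ u → f i ≡ 0ℚ) → ∑ k f ≡ f u
∑-single (suc k) f Fin.zero f≗0 =
  trans (cong (f Fin.zero +_) (∑-zero k _ (λ i → f≗0 (Fin.suc i) (λ ()))))
        (ℚP.+-identityʳ (f Fin.zero))
∑-single (suc k) f (Fin.suc u) f≗0 =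
  trans (cong₂ _+_ (f≗0 Fin.zero (λ ()))
                   (∑-single k _ u (λ i i≢u → f≗0 (Fin.suc i) (i≢u ∘ FinP.suc-injective))))
        (ℚP.+-identityˡ _)

∑-distrib-- : ∀ k (f g : Fin k → ℚ) → ∑ k (λ i → f i - g i) ≡ ∑ k f - ∑ k g
∑-distrib-- zero    f g = refl
∑-distrib-- (suc k) f g =
  trans (cong ((f Fin.zero - g Fin.zero) +_) (∑-distrib-- k (λ i → f (Fin.suc i)) (λ i → g (Fin.suc i))))
        (interchange (f Fin.zero) (g Fin.zero) (∑ k (λ i → f (Fin.suc i))) (∑ k (λ i → g (Fin.suc i))))
  where
  interchange : ∀ a b c d → (a - b) + (c - d) ≡ (a + c) - (b + d)
  interchange = solve 4 (λ a b c d → (a :- b) :+ (c :- d) := (a :+ c) :- (b :+ d)) refl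

basis : Fin n → Fin n → ℚ
basis u i with i ≟ u
... | yes _ = 1ℚ
... | no  _ = 0ℚ

basis-≡ : (u : Fin n) → basis u u ≡ 1ℚ
basis-≡ u with u ≟ u
... | yes _   = refl
... | no  u≢u = contradiction refl u≢u

basis-≢ : {u i : Fin n} → i ≢ u → basis u i ≡ 0ℚ
basis-≢ {u = u} {i} i≢u with i ≟ u
... | yes i≡u = contradiction i≡u i≢u
... | no  _   = refl

basis-comm : (u i : Fin n) → basis u i ≡ basis i u
basis-comm u i with i ≟ u | u ≟ i
... | yes _   | yes _   = refl
... | yes i≡u | no  u≢i = contradiction (sym i≡u) u≢i
... | no  i≢u | yes u≡i = contradiction (sym u≡i) i≢u
... | no  _   | no  _   = refl

basis-reindex : {q : Fin k → Fin n} → Injective _≡_ _≡_ q → ∀ a b → basis (q a) (q b) ≡ basis a b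
basis-reindex {q = q} q-inj a b with q b ≟ q a | b ≟ a
... | yes _     | yes _   = refl
... | yes qb≡qa | no  b≢a = contradiction (q-inj qb≡qa) b≢a
... | no  qb≢qa | yes b≡a = contradiction (cong q b≡a) qb≢qa
... | no  _     | no  _   = refl

∑-*basis : ∀ k (f : Fin k → ℚ) u → ∑ k (λ i → f i * basis u i) ≡ f u
∑-*basis k f u =
  trans (∑-single k _ u (λ i i≢u → trans (cong (f i *_) (basis-≢ i≢u)) (ℚP.*-zeroʳ (f i))))
        (trans (cong (f u *_) (basis-≡ u)) (ℚP.*-identityʳ (f u)))

mulVec-basis-difference : (A : Fin n → Fin n → ℚ) (u v i : Fin n) →
  mulVec A (λ j → basis u j - basis v j) i ≡ A i u - A i v
mulVec-basis-difference {n} A u v i = begin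
  ∑ n (λ j → A i j * (basis u j - basis v j))              ≡⟨ ∑-cong n (λ j → *-distribˡ-- (A i j) _ _) ⟩
  ∑ n (λ j → A i j * basis u j - A i j * basis v j)        ≡⟨ ∑-distrib-- n _ _ ⟩
  ∑ n (λ j → A i j * basis u j) - ∑ n (λ j → A i j * basis v j)
                                                            ≡⟨ cong₂ _-_ (∑-*basis n (A i) u) (∑-*basis n (A i) v) ⟩
  A i u - A i v                                             ∎
  where
  open ≡-Reasoning
  *-distribˡ-- : ∀ a x y → a * (x - y) ≡ a * x - a * y
  *-distribˡ-- = solve 3 (λ a x y → a :* (x :- y) := a :* x :- a :* y) refl

pivots⇒linearlyIndependent : {vs : Fin k → Fin n → ℚ} (q : Fin k → Fin n) →
  (∀ a b → vs a (q b) ≡ basis a b) → LinearlyIndependent vs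
pivots⇒linearlyIndependent {k} {vs = vs} q pivot c ∑≡0 b = begin
  c b                                 ≡⟨ sym (∑-*basis k c b) ⟩
  ∑ k (λ a → c a * basis b a)         ≡⟨ ∑-cong k (λ a → cong (c a *_) (trans (basis-comm b a) (sym (pivot a b)))) ⟩
  ∑ k (λ a → c a * vs a (q b))        ≡⟨ ∑≡0 (q b) ⟩
  0ℚ                                  ∎
  where open ≡-Reasoning

Dominating : (Fin n → Fin n → ℚ) → Fin n → Set
Dominating A u = ∀ i → A i u ≡ 1ℚ - basis u i

dominating-pair-eigen : {A : Fin n → Fin n → ℚ} {u v : Fin n} → Dominating A u → Dominating A v →
  InEigenspace A (- 1ℚ) (λ j → basis u j - basis v j)
dominating-pair-eigen {A = A} {u} {v} dom-u dom-v i = begin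
  mulVec A (λ j → basis u j - basis v j) i         ≡⟨ mulVec-basis-difference A u v i ⟩
  A i u - A i v                                    ≡⟨ cong₂ _-_ (dom-u i) (dom-v i) ⟩
  (1ℚ - basis u i) - (1ℚ - basis v i)              ≡⟨ difference-of-complements (basis u i) (basis v i) ⟩
  - 1ℚ * (basis u i - basis v i)                   ∎
  where
  open ≡-Reasoning
  difference-of-complements : ∀ x y → (1ℚ - x) - (1ℚ - y) ≡ - 1ℚ * (x - y)
  difference-of-complements =
    solve 2 (λ x y → (con 1ℚ :- x) :- (con 1ℚ :- y) := :- con 1ℚ :* (x :- y)) refl

coprime⇒dominating : (u : Fin n) → (∀ i → i ≢ u → Coprime (vertex i) (vertex u)) →
  Dominating (TCGAdj n) u
coprime⇒dominating u coprime i with i ≟ u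
... | yes _   = refl
... | no  i≢u with gcd (vertex i) (vertex u) ℕ.≟ 1
...   | yes _   = refl
...   | no  gcd≢1 = contradiction (coprime⇒gcd≡1 (coprime i i≢u)) gcd≢1

-- For p < x write x = p + d with 0 < d < p, and use that p + d is coprime to p whenever d is.
prime⇒coprime-<2* : ∀ {p x} → Prime p → 0 < x → x < 2 ℕ.* p → x ≢ p → Coprime p x
prime⇒coprime-<2* {p} {x} pp 0<x x<2p x≢p with ℕP.<-cmp x p
... | tri< x<p _ _ = prime⇒coprime pp {{>-nonZero 0<x}} x<p
... | tri≈ _ x≡p _ = contradiction x≡p x≢p
... | tri> _ _ p<x =
  subst (Coprime p) p+d≡x (Coprime.sym (coprime-+ (Coprime.sym (prime⇒coprime pp {{>-nonZero 0<d}} d<p))))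
  where
  p+d≡x : p ℕ.+ (x ℕ.∸ p) ≡ x
  p+d≡x = ℕP.m+[n∸m]≡n (ℕP.<⇒≤ p<x)
  0<d : 0 < x ℕ.∸ p
  0<d = ℕP.m<n⇒0<n∸m p<x
  d<p : x ℕ.∸ p < p
  d<p = ℕP.+-cancelˡ-< p _ _ (subst₂ _<_ (sym p+d≡x) (cong (p ℕ.+_) (ℕP.+-identityʳ p)) x<2p)

vertexAt : ∀ x → .{{ℕ.NonZero x}} → x ≤ n → Fin n
vertexAt (suc x) x<n = fromℕ< x<n

vertex-vertexAt : ∀ x .{{_ : ℕ.NonZero x}} (x≤n : x ≤ n) → vertex (vertexAt x x≤n) ≡ x
vertex-vertexAt (suc x) x<n = cong suc (FinP.toℕ-fromℕ< x<n)

vertex-injective : Injective _≡_ _≡_ (vertex {n})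
vertex-injective = FinP.toℕ-injective ∘ ℕP.suc-injective

one-dominating : Dominating (TCGAdj (suc n)) Fin.zero
one-dominating = coprime⇒dominating Fin.zero (λ i _ → Coprime.sym (1-coprimeTo (vertex i)))

lookup-injective : {xs : List ℕ} → Unique xs → Injective _≡_ _≡_ (lookup xs)
lookup-injective {x ∷ xs} _               {Fin.zero}  {Fin.zero}  _  = refl
lookup-injective {x ∷ xs} (x∉xs ∷ _)      {Fin.zero}  {Fin.suc b} eq = contradiction eq (All.lookup x∉xs (∈-lookup b))
lookup-injective {x ∷ xs} (x∉xs ∷ _)      {Fin.suc a} {Fin.zero}  eq = contradiction (sym eq) (All.lookup x∉xs (∈-lookup a))
lookup-injective {x ∷ xs} (_    ∷ unique) {Fin.suc a} {Fin.suc b} eq = cong Fin.suc (lookup-injective unique eq)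

bigPrime? : (n q : ℕ) → Dec (Prime q × n < 2 ℕ.* q)
bigPrime? n q = prime? q ×-dec (n ℕ.<? 2 ℕ.* q)

bigPrimes-unique : Unique (bigPrimes n)
bigPrimes-unique {n} = Unique.filter⁺ (bigPrime? n) (Unique.upTo⁺ (suc n))

module BigPrime {n p : ℕ} (p∈bigPrimes : p ∈ bigPrimes n) where

  private
    membership : p ∈ upTo (suc n) × (Prime p × n < 2 ℕ.* p)
    membership = ∈-filter⁻ (bigPrime? n) p∈bigPrimes

  prime : Prime p
  prime = proj₁ (proj₂ membership)

  n<2p : n < 2 ℕ.* p
  n<2p = proj₂ (proj₂ membership)

  p≤n : p ≤ n
  p≤n = s≤s⁻¹ (∈-upTo⁻ (proj₁ membership))

  vertexOf : Fin n
  vertexOf = vertexAt p {{prime⇒nonZero prime}} p≤n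

  vertex-vertexOf : vertex vertexOf ≡ p
  vertex-vertexOf = vertex-vertexAt p {{prime⇒nonZero prime}} p≤n

  vertexOf-dominating : Dominating (TCGAdj n) vertexOf
  vertexOf-dominating = coprime⇒dominating vertexOf λ i i≢p →
    subst (Coprime (vertex i)) (sym vertex-vertexOf) (Coprime.sym
      (prime⇒coprime-<2* prime ℕ.z<s (ℕP.≤-<-trans (FinP.toℕ<n i) n<2p)
        (λ i≡p → i≢p (vertex-injective (trans i≡p (sym vertex-vertexOf))))))

  vertex-vertexOf≢1 : vertex vertexOf ≢ 1
  vertex-vertexOf≢1 = subst (_≢ 1) (sym vertex-vertexOf) (ℕ.nonTrivial⇒≢1 {{prime⇒nonTrivial prime}})

bigPrimeVertex : (n : ℕ) → Fin (length (bigPrimes n)) → Fin n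
bigPrimeVertex n a = BigPrime.vertexOf {n} (∈-lookup a)

bigPrimeVertex-injective : Injective _≡_ _≡_ (bigPrimeVertex n)
bigPrimeVertex-injective {n} {a} {b} eq = lookup-injective (bigPrimes-unique {n}) (begin
  lookup (bigPrimes n) a           ≡⟨ BigPrime.vertex-vertexOf {n} (∈-lookup a) ⟨
  vertex (bigPrimeVertex n a)      ≡⟨ cong vertex eq ⟩
  vertex (bigPrimeVertex n b)      ≡⟨ BigPrime.vertex-vertexOf {n} (∈-lookup b) ⟩
  lookup (bigPrimes n) b           ∎)
  where open ≡-Reasoning

mainTheorem9 : (n : ℕ) → 1 ≤ n →
    EigenvalueMultAtLeast (TCGAdj n) (- 1ℚ) (length (bigPrimes n))
mainTheorem9 (suc n) _ =
  eigenvector , pivots⇒linearlyIndependent (bigPrimeVertex (suc n)) pivot , eigen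
  where
  eigenvector : Fin (length (bigPrimes (suc n))) → Fin (suc n) → ℚ
  eigenvector a j = basis (bigPrimeVertex (suc n) a) j - basis Fin.zero j

  pivot : ∀ a b → eigenvector a (bigPrimeVertex (suc n) b) ≡ basis a b
  pivot a b = trans
    (cong₂ _-_ (basis-reindex (bigPrimeVertex-injective {suc n}) a b)
               (basis-≢ (BigPrime.vertex-vertexOf≢1 {suc n} (∈-lookup b) ∘ cong vertex)))
    (ℚP.+-identityʳ (basis a b))

  eigen : ∀ a → InEigenspace (TCGAdj (suc n)) (- 1ℚ) (eigenvector a)
  eigen a = dominating-pair-eigen {A = TCGAdj (suc n)}
    (BigPrime.vertexOf-dominating {suc n} (∈-lookup a)) one-dominating
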